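{- For real or complex $\alpha,\beta,\gamma_1,\gamma_2,\lambda_1,\lambda_2,x$ and every integer $n\ge0$, $$\sum_{k=0}^{n}\binom{n}{k}A^{\lambda_1,x}_{k}(\alpha,\beta,\alpha+\beta+\gamma_1)\,A^{\lambda_2,x}_{n-k}(\alpha,\beta,\gamma_2)=A^{\lambda_1+\lambda_2,x}_{n}(\alpha,\beta,\alpha+\beta+\gamma_1+\gamma_2).$$
   Context: For a number $\alpha$ and integer $n\ge0$, $(t|\alpha)_n=t(t-\alpha)\cdots(t-(n-1)\alpha)$, $(t|\alpha)_0=1$. For numbers $\alpha,\beta,\gamma$ the generalised Stirling numbers $S(n,k,\alpha,\beta,\gamma)$, $0\le k\le n$, are defined by the polynomial identity $(t|\alpha)_n=\sum_{k=0}^{n}S(n,k,\alpha,\beta,\gamma)(t-\gamma|\beta)_k$. For a number $\lambda$ and integer $k\ge0$, $\binom{k+\lambda-1}{k}=\lambda(\lambda+1)\cdots(\lambda+k-1)/k!$ (equal to $1$ for $k=0$). Define $$A^{\lambda,x}_n(\alpha,\beta,\gamma)=\sum_{k=0}^{n}\binom{k+\lambda-1}{k}(-1)^{n+k}\beta^k k!\,S(n,k,\alpha,-\beta,-\gamma)\,x^k.$$ For $\alpha\neq0$ these have exponential generating function $\sum_{n\ge0}A^{\lambda,x}_n(\alpha,\beta,\gamma)\frac{t^n}{n!}=(1-\alpha t)^{ -\gamma/\alpha}\bigl[1-x((1-\alpha t)^{ -\beta/\alpha}-1)\bigr]^{ -\lambda}$. -}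

module Defs where

open import Level using (Level)
open import Algebra.Bundles using (CommutativeRing)
open import Data.Nat using (ℕ; zero; suc) renaming (_+_ to _+ℕ_)
open import Data.Nat.Combinatorics using (_C_)

-- All notions are defined over an arbitrary commutative ring R
-- (which covers ℝ and ℂ).
module WithRing {c ℓ : Level} (R : CommutativeRing c ℓ) where
  open CommutativeRing R hiding (zero)

  ι : ℕ → Carrier
  ι zero    = 0#
  ι (suc n) = 1# + ι n

  pow : Carrier → ℕ → Carrier
  pow a zero    = 1#
  pow a (suc n) = a * pow a n

  sumTo : ℕ → (ℕ → Carrier) → Carrier
  sumTo zero    f = f 0
  sumTo (suc n) f = sumTo n f + f (suc n)

  -- generalised falling factorial (t|α)_n = t(t-α)⋯(t-(n-1)α)
  gfall : Carrier → Carrier → ℕ → Carrier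
  gfall t α zero    = 1#
  gfall t α (suc n) = gfall t α n * (t - ι n * α)

  -- generalised Stirling numbers S(n,k,α,β,γ): the coefficients in
  --   (t|α)_n = Σ_{k=0}^{n} S(n,k,α,β,γ) (t-γ|β)_k .
  -- Since (t|α)_{n+1} = (t|α)_n (t - nα) and
  --   (t-γ|β)_k (t - nα) = (t-γ|β)_{k+1} + (γ + kβ - nα)(t-γ|β)_k,
  -- they are given by the recurrence below (the (t-γ|β)_k are monic of
  -- degree k, so these coefficients are the unique ones).
  S : ℕ → ℕ → Carrier → Carrier → Carrier → Carrier
  S zero    zero    α β γ = 1#
  S zero    (suc k) α β γ = 0#
  S (suc n) zero    α β γ = (γ - ι n * α) * S n zero α β γ
  S (suc n) (suc k) α β γ =
    S n k α β γ + (γ + ι (suc k) * β - ι n * α) * S n (suc k) α β γ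

  -- k! · binom(k+λ-1, k) = λ(λ+1)⋯(λ+k-1)   (rising factorial)
  rising : Carrier → ℕ → Carrier
  rising λ′ zero    = 1#
  rising λ′ (suc k) = rising λ′ k * (λ′ + ι k)

  -- A^{λ,x}_n(α,β,γ)
  --  = Σ_k binom(k+λ-1,k) (-1)^{n+k} β^k k! S(n,k,α,-β,-γ) x^k
  -- with the product binom(k+λ-1,k)·k! written as rising λ k.
  A : Carrier → Carrier → ℕ → Carrier → Carrier → Carrier → Carrier
  A λ′ x n α β γ =
    sumTo n (λ k → rising λ′ k * pow (- 1#) (n +ℕ k) * pow β k
                    * S n k α (- β) (- γ) * pow x k)

  binom : ℕ → ℕ → Carrier
  binom n k = ι (n C k)

{-# OPTIONS --safe #-}
-- Differentiating the generating function in t shows that, for fixed α, β, x,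
--   A^λ_{n+1}(γ) = (γ + nα − λβ) A^λ_n(γ) + λβ(1 + x) A^{λ+1}_n(γ);
-- coefficientwise this is the recurrence of the Stirling numbers together with
-- k (λ)_k = λ (λ+1)_k − λ (λ)_k for the rising factorial. The binomial
-- convolution of two sequences obeys the Leibniz rule, and the coefficient
-- γ + nα − λβ is additive in (γ, λ, n), so the convolution of A^{λ₁}(γ₁) and
-- A^{λ₂}(γ₂) satisfies the same recurrence as A^{λ₁+λ₂}(γ₁ + γ₂), simultaneously
-- for all λ₁, λ₂; induction on n gives the identity for arbitrary γ₁, γ₂, and the
-- theorem is the case where γ₁ is replaced by α + β + γ₁.
module Submission where

open import Defs
open import Level using (Level)
open import Algebra.Bundles using (CommutativeRing)
open import Data.Nat using (ℕ; _∸_)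

open import Data.Nat using (zero; suc; _≤_; _<_; z≤n; s≤s) renaming (_+_ to _+ℕ_; _*_ to _*ℕ_)
open import Data.Nat.Properties using (+-suc; m+[n∸m]≡n; m<n⇒m<1+n; ≤-refl; m≤n⇒m≤1+n; n<1+n; +-∸-assoc)
open import Data.Nat.Combinatorics using (_C_; k>n⇒nCk≡0; nCk+nC[k+1]≡[n+1]C[k+1])
open import Function using (_∘_)
open import Data.Integer as Int using (ℤ; +_; -[1+_]; _⊖_; _◃_; sign; ∣_∣)
import Data.Integer.Properties as Int
open import Data.Sign as Sign using (Sign)
open import Data.Maybe using (map)
open import Relation.Nullary.Decidable using (dec⇒maybe)
open import Relation.Binary.PropositionalEquality using (cong)
open import Algebra.Solver.Ring.AlmostCommutativeRing using (_-Raw-AlmostCommutative⟶_; fromCommutativeRing)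
import Algebra.Solver.Ring
import Relation.Binary.Reasoning.Setoid

-- Tactic.RingSolver cannot recognise the operations of a ring that is a
-- variable, so Algebra.Solver.Ring is instantiated with ℤ as coefficients.
module IntegerCoefficientSolver {c ℓ : Level} (R : CommutativeRing c ℓ) where
  open CommutativeRing R
  open import Algebra.Properties.Ring ring using (-1*x≈-x; -0#≈0#; -‿involutive; -‿+-comm)
  open import Algebra.Properties.Semiring.Mult.TCOptimised semiring using (_×_; 1+×; ×-homo-+; ×-cong; ×1-homo-*)
  open import Algebra.Properties.CommutativeSemigroup +-commutativeSemigroup
    using () renaming (interchange to +-interchange)
  open import Algebra.Properties.CommutativeSemigroup *-commutativeSemigroup
    using () renaming (interchange to *-interchange)
  open Relation.Binary.Reasoning.Setoid setoid

  [a+x]-[a+y]≈x-y : ∀ a x y → (a + x) - (a + y) ≈ x - y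
  [a+x]-[a+y]≈x-y a x y = begin
    (a + x) - (a + y)      ≈⟨ +-congˡ (-‿+-comm a y) ⟨
    (a + x) + (- a + - y)  ≈⟨ +-interchange a x (- a) (- y) ⟩
    (a - a) + (x - y)      ≈⟨ +-congʳ (-‿inverseʳ a) ⟩
    0# + (x - y)           ≈⟨ +-identityˡ (x - y) ⟩
    x - y                  ∎

  -- The type-checking-optimised _×_ makes ⟦ + 1 ⟧ reduce to 1#, so that
  -- the solver's constant con (+ 1) is 1# on the nose.
  ⟦_⟧ : ℤ → Carrier
  ⟦ + n ⟧      = n × 1#
  ⟦ -[1+ n ] ⟧ = - (suc n × 1#)

  ⟦⊖⟧ : ∀ m n → ⟦ m ⊖ n ⟧ ≈ m × 1# - n × 1#
  ⟦⊖⟧ m       zero    = begin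
    m × 1#       ≈⟨ +-identityʳ (m × 1#) ⟨
    m × 1# + 0#  ≈⟨ +-congˡ -0#≈0# ⟨
    m × 1# - 0#  ∎
  ⟦⊖⟧ zero    (suc n) = sym (+-identityˡ _)
  ⟦⊖⟧ (suc m) (suc n) = begin
    ⟦ suc m ⊖ suc n ⟧                  ≡⟨ cong ⟦_⟧ (Int.[1+m]⊖[1+n]≡m⊖n m n) ⟩
    ⟦ m ⊖ n ⟧                          ≈⟨ ⟦⊖⟧ m n ⟩
    m × 1# - n × 1#                    ≈⟨ [a+x]-[a+y]≈x-y 1# (m × 1#) (n × 1#) ⟨
    (1# + m × 1#) - (1# + n × 1#)      ≈⟨ +-cong (1+× m 1#) (-‿cong (1+× n 1#)) ⟨
    suc m × 1# - suc n × 1#            ∎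

  ⟦+⟧ : ∀ i j → ⟦ i Int.+ j ⟧ ≈ ⟦ i ⟧ + ⟦ j ⟧
  ⟦+⟧ (+ m)    (+ n)    = ×-homo-+ 1# m n
  ⟦+⟧ (+ m)    -[1+ n ] = ⟦⊖⟧ m (suc n)
  ⟦+⟧ -[1+ m ] (+ n)    = trans (⟦⊖⟧ n (suc m)) (+-comm (n × 1#) _)
  ⟦+⟧ -[1+ m ] -[1+ n ] = begin
    - (suc (suc m +ℕ n) × 1#)            ≈⟨ -‿cong (×-cong (+-suc (suc m) n) refl) ⟨
    - ((suc m +ℕ suc n) × 1#)            ≈⟨ -‿cong (×-homo-+ 1# (suc m) (suc n)) ⟩
    - (suc m × 1# + suc n × 1#)          ≈⟨ -‿+-comm _ _ ⟨
    - (suc m × 1#) + - (suc n × 1#)      ∎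

  ⟦_⟧ₛ : Sign → Carrier
  ⟦ Sign.+ ⟧ₛ = 1#
  ⟦ Sign.- ⟧ₛ = - 1#

  ⟦*⟧ₛ : ∀ s t → ⟦ s Sign.* t ⟧ₛ ≈ ⟦ s ⟧ₛ * ⟦ t ⟧ₛ
  ⟦*⟧ₛ Sign.+ t      = sym (*-identityˡ _)
  ⟦*⟧ₛ Sign.- Sign.+ = sym (*-identityʳ _)
  ⟦*⟧ₛ Sign.- Sign.- = trans (sym (-‿involutive 1#)) (sym (-1*x≈-x (- 1#)))

  ⟦◃⟧ : ∀ s n → ⟦ s ◃ n ⟧ ≈ ⟦ s ⟧ₛ * (n × 1#)
  ⟦◃⟧ s      zero    = sym (zeroʳ _)
  ⟦◃⟧ Sign.+ (suc n) = sym (*-identityˡ _)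
  ⟦◃⟧ Sign.- (suc n) = sym (-1*x≈-x _)

  ⟦⟧≈sign*abs : ∀ i → ⟦ i ⟧ ≈ ⟦ sign i ⟧ₛ * (∣ i ∣ × 1#)
  ⟦⟧≈sign*abs i = begin
    ⟦ i ⟧                       ≡⟨ cong ⟦_⟧ (Int.◃-inverse i) ⟨
    ⟦ sign i ◃ ∣ i ∣ ⟧          ≈⟨ ⟦◃⟧ (sign i) ∣ i ∣ ⟩
    ⟦ sign i ⟧ₛ * (∣ i ∣ × 1#)  ∎

  ⟦*⟧ : ∀ i j → ⟦ i Int.* j ⟧ ≈ ⟦ i ⟧ * ⟦ j ⟧
  ⟦*⟧ i j = begin
    ⟦ (sign i Sign.* sign j) ◃ (∣ i ∣ *ℕ ∣ j ∣) ⟧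
      ≈⟨ ⟦◃⟧ (sign i Sign.* sign j) (∣ i ∣ *ℕ ∣ j ∣) ⟩
    ⟦ sign i Sign.* sign j ⟧ₛ * ((∣ i ∣ *ℕ ∣ j ∣) × 1#)
      ≈⟨ *-cong (⟦*⟧ₛ (sign i) (sign j)) (×1-homo-* ∣ i ∣ ∣ j ∣) ⟩
    (⟦ sign i ⟧ₛ * ⟦ sign j ⟧ₛ) * ((∣ i ∣ × 1#) * (∣ j ∣ × 1#))
      ≈⟨ *-interchange _ _ _ _ ⟩
    (⟦ sign i ⟧ₛ * (∣ i ∣ × 1#)) * (⟦ sign j ⟧ₛ * (∣ j ∣ × 1#))
      ≈⟨ *-cong (⟦⟧≈sign*abs i) (⟦⟧≈sign*abs j) ⟨
    ⟦ i ⟧ * ⟦ j ⟧ ∎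

  ⟦-⟧ : ∀ i → ⟦ Int.- i ⟧ ≈ - ⟦ i ⟧
  ⟦-⟧ (+ zero)  = sym -0#≈0#
  ⟦-⟧ (+ suc n) = refl
  ⟦-⟧ -[1+ n ]  = sym (-‿involutive _)

  homomorphism : Int.+-*-rawRing -Raw-AlmostCommutative⟶ fromCommutativeRing R
  homomorphism = record
    { ⟦_⟧ = ⟦_⟧ ; +-homo = ⟦+⟧ ; *-homo = ⟦*⟧ ; -‿homo = ⟦-⟧ ; 0-homo = refl ; 1-homo = refl }

  open Algebra.Solver.Ring Int.+-*-rawRing (fromCommutativeRing R) homomorphism
    (λ i j → map (λ i≡j → reflexive (cong ⟦_⟧ i≡j)) (dec⇒maybe (i Int.≟ j)))
    public using (solve; con; _:+_; _:*_; _:-_; :-_; _:=_)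

module FiniteSums {c ℓ : Level} (R : CommutativeRing c ℓ) where
  open CommutativeRing R hiding (zero)
  open WithRing R
  open import Algebra.Properties.CommutativeSemigroup +-commutativeSemigroup using (interchange; x∙yz≈y∙xz)
  open Relation.Binary.Reasoning.Setoid setoid

  ι-+ : ∀ m n → ι (m +ℕ n) ≈ ι m + ι n
  ι-+ zero    n = sym (+-identityˡ (ι n))
  ι-+ (suc m) n = trans (+-congˡ (ι-+ m n)) (sym (+-assoc 1# (ι m) (ι n)))

  sumTo-cong : ∀ n {f g : ℕ → Carrier} → (∀ k → k ≤ n → f k ≈ g k) → sumTo n f ≈ sumTo n g
  sumTo-cong zero    f≈g = f≈g 0 z≤n
  sumTo-cong (suc n) f≈g = +-cong (sumTo-cong n (λ k k≤n → f≈g k (m≤n⇒m≤1+n k≤n))) (f≈g (suc n) ≤-refl)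

  sumTo-+ : ∀ n (f g : ℕ → Carrier) → sumTo n (λ k → f k + g k) ≈ sumTo n f + sumTo n g
  sumTo-+ zero    f g = refl
  sumTo-+ (suc n) f g = trans (+-congʳ (sumTo-+ n f g)) (interchange _ _ _ _)

  sumTo-*ˡ : ∀ n a (f : ℕ → Carrier) → sumTo n (λ k → a * f k) ≈ a * sumTo n f
  sumTo-*ˡ zero    a f = refl
  sumTo-*ˡ (suc n) a f = trans (+-congʳ (sumTo-*ˡ n a f)) (sym (distribˡ a _ _))

  sumTo-linear₃ : ∀ n a b d (f g h : ℕ → Carrier) →
    sumTo n (λ k → a * f k + b * g k + d * h k) ≈ a * sumTo n f + b * sumTo n g + d * sumTo n h
  sumTo-linear₃ n a b d f g h = begin
    sumTo n (λ k → a * f k + b * g k + d * h k)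
      ≈⟨ trans (sumTo-+ n _ _) (+-congʳ (sumTo-+ n _ _)) ⟩
    sumTo n (λ k → a * f k) + sumTo n (λ k → b * g k) + sumTo n (λ k → d * h k)
      ≈⟨ +-cong (+-cong (sumTo-*ˡ n a f) (sumTo-*ˡ n b g)) (sumTo-*ˡ n d h) ⟩
    a * sumTo n f + b * sumTo n g + d * sumTo n h ∎

  sumTo-suc-head : ∀ n (f : ℕ → Carrier) → sumTo (suc n) f ≈ f 0 + sumTo n (f ∘ suc)
  sumTo-suc-head zero    f = refl
  sumTo-suc-head (suc n) f = trans (+-congʳ (sumTo-suc-head n f)) (+-assoc _ _ _)

  sumTo-suc-last≈0 : ∀ n (f : ℕ → Carrier) → f (suc n) ≈ 0# → sumTo (suc n) f ≈ sumTo n f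
  sumTo-suc-last≈0 n f fₙ₊₁≈0 = trans (+-congˡ fₙ₊₁≈0) (+-identityʳ _)

  -- The exponential generating function of f ⊛ g is the product of those of f and g.
  infixl 7 _⊛_
  _⊛_ : (ℕ → Carrier) → (ℕ → Carrier) → ℕ → Carrier
  (f ⊛ g) n = sumTo n (λ k → binom n k * f k * g (n ∸ k))

  binom-suc-suc : ∀ n k → binom (suc n) (suc k) ≈ binom n k + binom n (suc k)
  binom-suc-suc n k = begin
    ι (suc n C suc k)              ≡⟨ cong ι (nCk+nC[k+1]≡[n+1]C[k+1] n k) ⟨
    ι (n C k +ℕ n C suc k)         ≈⟨ ι-+ (n C k) (n C suc k) ⟩
    binom n k + binom n (suc k)    ∎

  binom-suc : ∀ n → binom n (suc n) ≈ 0#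
  binom-suc n = reflexive (cong ι (k>n⇒nCk≡0 (n<1+n n)))

  ⊛-suc : ∀ f g n → (f ⊛ g) (suc n) ≈ ((f ∘ suc) ⊛ g) n + (f ⊛ (g ∘ suc)) n
  ⊛-suc f g n = begin
    (f ⊛ g) (suc n)
      ≈⟨ sumTo-suc-head n _ ⟩
    h₀ + sumTo n (λ k → binom (suc n) (suc k) * f (suc k) * g (n ∸ k))
      ≈⟨ +-congˡ (trans (sumTo-cong n (λ k _ → pascal k)) (sumTo-+ n _ _)) ⟩
    h₀ + (((f ∘ suc) ⊛ g) n + sumTo n upper)
      ≈⟨ x∙yz≈y∙xz _ _ _ ⟩
    ((f ∘ suc) ⊛ g) n + (h₀ + sumTo n upper)
      ≈⟨ +-congˡ (sumTo-suc-head n _) ⟨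
    ((f ∘ suc) ⊛ g) n + sumTo (suc n) (λ k → binom n k * f k * g (suc n ∸ k))
      ≈⟨ +-congˡ (sumTo-suc-last≈0 n _ (trans (*-congʳ (trans (*-congʳ (binom-suc n)) (zeroˡ _))) (zeroˡ _))) ⟩
    ((f ∘ suc) ⊛ g) n + sumTo n (λ k → binom n k * f k * g (suc n ∸ k))
      ≈⟨ +-congˡ (sumTo-cong n (λ k k≤n → *-congˡ (reflexive (cong g (+-∸-assoc 1 k≤n))))) ⟩
    ((f ∘ suc) ⊛ g) n + (f ⊛ (g ∘ suc)) n ∎
    where
      h₀ = binom (suc n) 0 * f 0 * g (suc n)
      upper : ℕ → Carrier
      upper k = binom n (suc k) * f (suc k) * g (n ∸ k)
      pascal : ∀ k → binom (suc n) (suc k) * f (suc k) * g (n ∸ k)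
                     ≈ binom n k * f (suc k) * g (n ∸ k) + upper k
      pascal k = trans (*-congʳ (trans (*-congʳ (binom-suc-suc n k)) (distribʳ _ _ _))) (distribʳ _ _ _)

module Properties {c ℓ : Level} (R : CommutativeRing c ℓ) where
  open CommutativeRing R hiding (zero)
  open WithRing R
  open IntegerCoefficientSolver R
  open FiniteSums R
  open import Algebra.Properties.CommutativeSemigroup +-commutativeSemigroup using (xy∙z≈xz∙y)
  open Relation.Binary.Reasoning.Setoid setoid

  rising-cong : ∀ k {λ′ λ″} → λ′ ≈ λ″ → rising λ′ k ≈ rising λ″ k
  rising-cong zero    λ′≈λ″ = refl
  rising-cong (suc k) λ′≈λ″ = *-cong (rising-cong k λ′≈λ″) (+-congʳ λ′≈λ″)

  rising-suc : ∀ λ′ k → rising λ′ (suc k) ≈ λ′ * rising (λ′ + 1#) k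
  rising-suc λ′ zero    = solve 1 (λ l → con (+ 1) :* (l :+ con (+ 0)) := l :* con (+ 1)) refl λ′
  rising-suc λ′ (suc k) = begin
    rising λ′ (suc k) * (λ′ + ι (suc k))          ≈⟨ *-congʳ (rising-suc λ′ k) ⟩
    λ′ * rising (λ′ + 1#) k * (λ′ + (1# + ι k))   ≈⟨ solve 3 (λ l r i → l :* r :* (l :+ (con (+ 1) :+ i))
                                                               := l :* (r :* (l :+ con (+ 1) :+ i)))
                                                            refl λ′ (rising (λ′ + 1#) k) (ι k) ⟩
    λ′ * rising (λ′ + 1#) (suc k)                 ∎

  ι*rising : ∀ λ′ k → ι k * rising λ′ k ≈ λ′ * rising (λ′ + 1#) k - λ′ * rising λ′ k
  ι*rising λ′ k = begin
    ι k * rising λ′ k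
      ≈⟨ solve 3 (λ i r l → i :* r := r :* (l :+ i) :- l :* r) refl (ι k) (rising λ′ k) λ′ ⟩
    rising λ′ (suc k) - λ′ * rising λ′ k        ≈⟨ +-congʳ (rising-suc λ′ k) ⟩
    λ′ * rising (λ′ + 1#) k - λ′ * rising λ′ k  ∎

  S-vanish : ∀ α β γ {n k} → n < k → S n k α β γ ≈ 0#
  S-vanish α β γ {zero}  {suc k} _         = refl
  S-vanish α β γ {suc n} {suc k} (s≤s n<k) = begin
    S n k α β γ + (γ + ι (suc k) * β - ι n * α) * S n (suc k) α β γ
      ≈⟨ +-cong (S-vanish α β γ n<k) (*-congˡ (S-vanish α β γ (m<n⇒m<1+n n<k))) ⟩
    0# + (γ + ι (suc k) * β - ι n * α) * 0#  ≈⟨ trans (+-identityˡ _) (zeroʳ _) ⟩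
    0# ∎

  module _ (α β x : Carrier) where

    signedS : Carrier → ℕ → ℕ → Carrier
    signedS γ n k = pow (- 1#) (n +ℕ k) * pow β k * S n k α (- β) (- γ)

    signedS⁻ : Carrier → ℕ → ℕ → Carrier
    signedS⁻ γ n zero    = 0#
    signedS⁻ γ n (suc k) = signedS γ n k

    u*signedS*v≈0 : ∀ γ n u v → u * signedS γ n (suc n) * v ≈ 0#
    u*signedS*v≈0 γ n u v = trans (*-congʳ (trans (*-congˡ signedS≈0) (zeroʳ u))) (zeroˡ v)
      where
        signedS≈0 : signedS γ n (suc n) ≈ 0#
        signedS≈0 = trans (*-congˡ (S-vanish α (- β) (- γ) (n<1+n n))) (zeroʳ _)

    signedS-suc : ∀ γ n k →
      signedS γ (suc n) k ≈ β * signedS⁻ γ n k + (γ + ι k * β + ι n * α) * signedS γ n k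
    signedS-suc γ n zero = solve 6 (λ p s g i a b →
        (:- con (+ 1) :* p) :* con (+ 1) :* ((:- g :- i :* a) :* s)
        := b :* con (+ 0) :+ (g :+ con (+ 0) :* b :+ i :* a) :* (p :* con (+ 1) :* s))
      refl (pow (- 1#) (n +ℕ 0)) (S n 0 α (- β) (- γ)) γ (ι n) α β
    signedS-suc γ n (suc k) = begin
      - 1# * pow (- 1#) (n +ℕ suc k) * pow β (suc k) * (s₁ + (- γ + i * - β - ι n * α) * s₂)
        ≈⟨ *-congʳ (*-congʳ (*-congˡ sign-suc)) ⟩
      - 1# * (- 1# * p) * (β * q) * (s₁ + (- γ + i * - β - ι n * α) * s₂)
        ≈⟨ solve 9 (λ p q s₁ s₂ g i j a b →
             :- con (+ 1) :* (:- con (+ 1) :* p) :* (b :* q) :* (s₁ :+ (:- g :+ i :* (:- b) :- j :* a) :* s₂)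
             := b :* (p :* q :* s₁) :+ (g :+ i :* b :+ j :* a) :* (:- con (+ 1) :* p :* (b :* q) :* s₂))
           refl p q s₁ s₂ γ i (ι n) α β ⟩
      β * (p * q * s₁) + (γ + i * β + ι n * α) * (- 1# * p * (β * q) * s₂)
        ≈⟨ +-congˡ (*-congˡ (*-congʳ (*-congʳ sign-suc))) ⟨
      β * signedS γ n k + (γ + i * β + ι n * α) * signedS γ n (suc k) ∎
      where
        p = pow (- 1#) (n +ℕ k)
        q = pow β k
        i = ι (suc k)
        s₁ = S n k α (- β) (- γ)
        s₂ = S n (suc k) α (- β) (- γ)
        sign-suc : pow (- 1#) (n +ℕ suc k) ≈ - 1# * p
        sign-suc = reflexive (cong (pow (- 1#)) (+-suc n k))

    Aseq : Carrier → Carrier → ℕ → Carrier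
    Aseq λ′ γ n = A λ′ x n α β γ

    term : Carrier → Carrier → ℕ → ℕ → Carrier
    term λ′ γ n k = rising λ′ k * signedS γ n k * pow x k

    Aseq≈sumTo-term : ∀ λ′ γ n → Aseq λ′ γ n ≈ sumTo n (term λ′ γ n)
    Aseq≈sumTo-term λ′ γ n = sumTo-cong n (λ k _ →
      *-congʳ (trans (*-congʳ (*-assoc _ _ _)) (*-assoc _ _ _)))

    Aseq-zero : ∀ λ′ γ → Aseq λ′ γ 0 ≈ 1#
    Aseq-zero λ′ γ = solve 0 (con (+ 1) :* con (+ 1) :* con (+ 1) :* con (+ 1) :* con (+ 1) := con (+ 1)) refl

    Aseq-cong : ∀ {λ′ λ″} γ n → λ′ ≈ λ″ → Aseq λ′ γ n ≈ Aseq λ″ γ n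
    Aseq-cong γ n λ′≈λ″ = sumTo-cong n (λ k _ →
      *-congʳ (*-congʳ (*-congʳ (*-congʳ (rising-cong k λ′≈λ″)))))

    sumTo-signedS⁻ : ∀ λ′ γ n →
      sumTo (suc n) (λ k → rising λ′ k * signedS⁻ γ n k * pow x k) ≈ λ′ * x * Aseq (λ′ + 1#) γ n
    sumTo-signedS⁻ λ′ γ n = begin
      sumTo (suc n) (λ k → rising λ′ k * signedS⁻ γ n k * pow x k)
        ≈⟨ sumTo-suc-head n _ ⟩
      1# * 0# * 1# + sumTo n (λ k → rising λ′ (suc k) * signedS γ n k * pow x (suc k))
        ≈⟨ +-cong (trans (*-congʳ (zeroʳ 1#)) (zeroˡ 1#)) (sumTo-cong n (λ k _ → lowered k)) ⟩
      0# + sumTo n (λ k → λ′ * x * term (λ′ + 1#) γ n k)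
        ≈⟨ trans (+-identityˡ _) (sumTo-*ˡ n (λ′ * x) _) ⟩
      λ′ * x * sumTo n (term (λ′ + 1#) γ n)
        ≈⟨ *-congˡ (Aseq≈sumTo-term (λ′ + 1#) γ n) ⟨
      λ′ * x * Aseq (λ′ + 1#) γ n ∎
      where
        lowered : ∀ k → rising λ′ (suc k) * signedS γ n k * pow x (suc k) ≈ λ′ * x * term (λ′ + 1#) γ n k
        lowered k = trans (*-congʳ (*-congʳ (rising-suc λ′ k)))
          (solve 5 (λ l r s y X → l :* r :* s :* (y :* X) := l :* y :* (r :* s :* X))
            refl λ′ (rising (λ′ + 1#) k) (signedS γ n k) x (pow x k))

    sumTo-ι*term : ∀ λ′ γ n →
      sumTo (suc n) (λ k → ι k * rising λ′ k * signedS γ n k * pow x k)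
      ≈ λ′ * Aseq (λ′ + 1#) γ n + - λ′ * Aseq λ′ γ n
    sumTo-ι*term λ′ γ n = begin
      sumTo (suc n) (λ k → ι k * rising λ′ k * signedS γ n k * pow x k)
        ≈⟨ sumTo-suc-last≈0 n _ (u*signedS*v≈0 γ n _ _) ⟩
      sumTo n (λ k → ι k * rising λ′ k * signedS γ n k * pow x k)
        ≈⟨ sumTo-cong n (λ k _ → split k) ⟩
      sumTo n (λ k → λ′ * term (λ′ + 1#) γ n k + - λ′ * term λ′ γ n k)
        ≈⟨ trans (sumTo-+ n _ _) (+-cong (sumTo-*ˡ n λ′ _) (sumTo-*ˡ n (- λ′) _)) ⟩
      λ′ * sumTo n (term (λ′ + 1#) γ n) + - λ′ * sumTo n (term λ′ γ n)
        ≈⟨ +-cong (*-congˡ (Aseq≈sumTo-term (λ′ + 1#) γ n)) (*-congˡ (Aseq≈sumTo-term λ′ γ n)) ⟨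
      λ′ * Aseq (λ′ + 1#) γ n + - λ′ * Aseq λ′ γ n ∎
      where
        split : ∀ k → ι k * rising λ′ k * signedS γ n k * pow x k
                      ≈ λ′ * term (λ′ + 1#) γ n k + - λ′ * term λ′ γ n k
        split k = trans (*-congʳ (*-congʳ (ι*rising λ′ k)))
          (solve 5 (λ l r′ r s X → (l :* r′ :- l :* r) :* s :* X := l :* (r′ :* s :* X) :+ (:- l) :* (r :* s :* X))
            refl λ′ (rising (λ′ + 1#) k) (rising λ′ k) (signedS γ n k) (pow x k))

    Aseq-suc : ∀ λ′ γ n →
      Aseq λ′ γ (suc n)
      ≈ (γ + ι n * α - λ′ * β) * Aseq λ′ γ n + λ′ * β * (1# + x) * Aseq (λ′ + 1#) γ n
    Aseq-suc λ′ γ n = begin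
      Aseq λ′ γ (suc n)
        ≈⟨ Aseq≈sumTo-term λ′ γ (suc n) ⟩
      sumTo (suc n) (term λ′ γ (suc n))
        ≈⟨ sumTo-cong (suc n) (λ k _ → term-suc k) ⟩
      sumTo (suc n) (λ k → β * lowered k + δ * term λ′ γ n k + β * weighted k)
        ≈⟨ sumTo-linear₃ (suc n) β δ β lowered (term λ′ γ n) weighted ⟩
      β * sumTo (suc n) lowered + δ * sumTo (suc n) (term λ′ γ n) + β * sumTo (suc n) weighted
        ≈⟨ +-cong (+-cong (*-congˡ (sumTo-signedS⁻ λ′ γ n)) (*-congˡ same))
                  (*-congˡ (sumTo-ι*term λ′ γ n)) ⟩
      β * (λ′ * x * A′) + δ * Aₙ + β * (λ′ * A′ + - λ′ * Aₙ)
        ≈⟨ solve 6 (λ b l y A′ Aₙ d → b :* (l :* y :* A′) :+ d :* Aₙ :+ b :* (l :* A′ :+ (:- l) :* Aₙ)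
                                    := (d :- l :* b) :* Aₙ :+ l :* b :* (con (+ 1) :+ y) :* A′)
             refl β λ′ x A′ Aₙ δ ⟩
      (δ - λ′ * β) * Aₙ + λ′ * β * (1# + x) * A′ ∎
      where
        δ  = γ + ι n * α
        Aₙ = Aseq λ′ γ n
        A′ = Aseq (λ′ + 1#) γ n
        lowered weighted : ℕ → Carrier
        lowered k  = rising λ′ k * signedS⁻ γ n k * pow x k
        weighted k = ι k * rising λ′ k * signedS γ n k * pow x k
        term-suc : ∀ k → term λ′ γ (suc n) k ≈ β * lowered k + δ * term λ′ γ n k + β * weighted k
        term-suc k = trans (*-congʳ (*-congˡ (signedS-suc γ n k)))
          (solve 9 (λ r b s⁻ g i j a s X →
               r :* (b :* s⁻ :+ (g :+ i :* b :+ j :* a) :* s) :* X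
               := b :* (r :* s⁻ :* X) :+ (g :+ j :* a) :* (r :* s :* X) :+ b :* (i :* r :* s :* X))
             refl (rising λ′ k) β (signedS⁻ γ n k) γ (ι k) (ι n) α (signedS γ n k) (pow x k))
        same : sumTo (suc n) (term λ′ γ n) ≈ Aₙ
        same = trans (sumTo-suc-last≈0 n _ (u*signedS*v≈0 γ n _ _)) (sym (Aseq≈sumTo-term λ′ γ n))

    Aseq-suc-coefficient-+ : ∀ λ₁ λ₂ γ₁ γ₂ {n k} → k ≤ n →
      (γ₁ + ι k * α - λ₁ * β) + (γ₂ + ι (n ∸ k) * α - λ₂ * β)
      ≈ γ₁ + γ₂ + ι n * α - (λ₁ + λ₂) * β
    Aseq-suc-coefficient-+ λ₁ λ₂ γ₁ γ₂ {n} {k} k≤n = begin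
      (γ₁ + ι k * α - λ₁ * β) + (γ₂ + ι (n ∸ k) * α - λ₂ * β)
        ≈⟨ solve 8 (λ g₁ g₂ i j a b l₁ l₂ → (g₁ :+ i :* a :- l₁ :* b) :+ (g₂ :+ j :* a :- l₂ :* b)
                                       := g₁ :+ g₂ :+ (i :+ j) :* a :- (l₁ :+ l₂) :* b)
             refl γ₁ γ₂ (ι k) (ι (n ∸ k)) α β λ₁ λ₂ ⟩
      γ₁ + γ₂ + (ι k + ι (n ∸ k)) * α - (λ₁ + λ₂) * β
        ≈⟨ +-congʳ (+-congˡ (*-congʳ ι[k]+ι[n∸k]≈ι[n])) ⟩
      γ₁ + γ₂ + ι n * α - (λ₁ + λ₂) * β ∎
      where
        ι[k]+ι[n∸k]≈ι[n] : ι k + ι (n ∸ k) ≈ ι n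
        ι[k]+ι[n∸k]≈ι[n] = trans (sym (ι-+ k (n ∸ k))) (reflexive (cong ι (m+[n∸m]≡n k≤n)))

    Aseq-suc-product : ∀ λ₁ λ₂ γ₁ γ₂ {n k} → k ≤ n →
      Aseq λ₁ γ₁ (suc k) * Aseq λ₂ γ₂ (n ∸ k) + Aseq λ₁ γ₁ k * Aseq λ₂ γ₂ (suc (n ∸ k))
      ≈ (γ₁ + γ₂ + ι n * α - (λ₁ + λ₂) * β) * (Aseq λ₁ γ₁ k * Aseq λ₂ γ₂ (n ∸ k))
        + λ₁ * β * (1# + x) * (Aseq (λ₁ + 1#) γ₁ k * Aseq λ₂ γ₂ (n ∸ k))
        + λ₂ * β * (1# + x) * (Aseq λ₁ γ₁ k * Aseq (λ₂ + 1#) γ₂ (n ∸ k))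
    Aseq-suc-product λ₁ λ₂ γ₁ γ₂ {n} {k} k≤n = begin
      a (suc k) * b (n ∸ k) + a k * b (suc (n ∸ k))
        ≈⟨ +-cong (*-congʳ (Aseq-suc λ₁ γ₁ k)) (*-congˡ (Aseq-suc λ₂ γ₂ (n ∸ k))) ⟩
      (δ₁ * a k + μ₁ * a⁺ k) * b (n ∸ k) + a k * (δ₂ * b (n ∸ k) + μ₂ * b⁺ (n ∸ k))
        ≈⟨ solve 8 (λ d₁ d₂ m₁ m₂ u u⁺ v v⁺ →
              (d₁ :* u :+ m₁ :* u⁺) :* v :+ u :* (d₂ :* v :+ m₂ :* v⁺)
              := (d₁ :+ d₂) :* (u :* v) :+ m₁ :* (u⁺ :* v) :+ m₂ :* (u :* v⁺))
            refl δ₁ δ₂ μ₁ μ₂ (a k) (a⁺ k) (b (n ∸ k)) (b⁺ (n ∸ k)) ⟩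
      (δ₁ + δ₂) * (a k * b (n ∸ k)) + μ₁ * (a⁺ k * b (n ∸ k)) + μ₂ * (a k * b⁺ (n ∸ k))
        ≈⟨ +-congʳ (+-congʳ (*-congʳ (Aseq-suc-coefficient-+ λ₁ λ₂ γ₁ γ₂ k≤n))) ⟩
      (γ₁ + γ₂ + ι n * α - (λ₁ + λ₂) * β) * (a k * b (n ∸ k))
        + μ₁ * (a⁺ k * b (n ∸ k)) + μ₂ * (a k * b⁺ (n ∸ k)) ∎
      where
        a a⁺ b b⁺ : ℕ → Carrier
        a  = Aseq λ₁ γ₁
        a⁺ = Aseq (λ₁ + 1#) γ₁
        b  = Aseq λ₂ γ₂
        b⁺ = Aseq (λ₂ + 1#) γ₂
        δ₁ = γ₁ + ι k * α - λ₁ * β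
        δ₂ = γ₂ + ι (n ∸ k) * α - λ₂ * β
        μ₁ = λ₁ * β * (1# + x)
        μ₂ = λ₂ * β * (1# + x)

    Aseq-convolution : ∀ λ₁ λ₂ γ₁ γ₂ n →
      (Aseq λ₁ γ₁ ⊛ Aseq λ₂ γ₂) n ≈ Aseq (λ₁ + λ₂) (γ₁ + γ₂) n
    Aseq-convolution λ₁ λ₂ γ₁ γ₂ zero = begin
      binom 0 0 * Aseq λ₁ γ₁ 0 * Aseq λ₂ γ₂ 0
        ≈⟨ *-cong (*-cong (+-identityʳ 1#) (Aseq-zero λ₁ γ₁)) (Aseq-zero λ₂ γ₂) ⟩
      1# * 1# * 1#                ≈⟨ trans (*-identityʳ _) (*-identityʳ _) ⟩
      1#                          ≈⟨ Aseq-zero (λ₁ + λ₂) (γ₁ + γ₂) ⟨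
      Aseq (λ₁ + λ₂) (γ₁ + γ₂) 0  ∎
    Aseq-convolution λ₁ λ₂ γ₁ γ₂ (suc n) = begin
      (a ⊛ b) (suc n)
        ≈⟨ ⊛-suc a b n ⟩
      ((a ∘ suc) ⊛ b) n + (a ⊛ (b ∘ suc)) n
        ≈⟨ sumTo-+ n _ _ ⟨
      sumTo n (λ k → binom n k * a (suc k) * b (n ∸ k) + binom n k * a k * b (suc (n ∸ k)))
        ≈⟨ sumTo-cong n leibniz-term ⟩
      sumTo n (λ k → δ * summand a b k + μ₁ * summand a⁺ b k + μ₂ * summand a b⁺ k)
        ≈⟨ sumTo-linear₃ n δ μ₁ μ₂ _ _ _ ⟩
      δ * (a ⊛ b) n + μ₁ * (a⁺ ⊛ b) n + μ₂ * (a ⊛ b⁺) n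
        ≈⟨ +-cong (+-cong (*-congˡ (Aseq-convolution λ₁ λ₂ γ₁ γ₂ n)) (*-congˡ IH₁)) (*-congˡ IH₂) ⟩
      δ * Aₙ + μ₁ * A′ + μ₂ * A′
        ≈⟨ trans (+-assoc _ _ _) (+-congˡ (trans (sym (distribʳ A′ μ₁ μ₂)) (*-congʳ μ-+))) ⟩
      δ * Aₙ + (λ₁ + λ₂) * β * (1# + x) * A′
        ≈⟨ Aseq-suc (λ₁ + λ₂) (γ₁ + γ₂) n ⟨
      Aseq (λ₁ + λ₂) (γ₁ + γ₂) (suc n) ∎
      where
        a a⁺ b b⁺ : ℕ → Carrier
        a  = Aseq λ₁ γ₁
        a⁺ = Aseq (λ₁ + 1#) γ₁
        b  = Aseq λ₂ γ₂
        b⁺ = Aseq (λ₂ + 1#) γ₂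
        summand : (ℕ → Carrier) → (ℕ → Carrier) → ℕ → Carrier
        summand f g k = binom n k * f k * g (n ∸ k)
        δ  = γ₁ + γ₂ + ι n * α - (λ₁ + λ₂) * β
        μ₁ = λ₁ * β * (1# + x)
        μ₂ = λ₂ * β * (1# + x)
        Aₙ = Aseq (λ₁ + λ₂) (γ₁ + γ₂) n
        A′ = Aseq (λ₁ + λ₂ + 1#) (γ₁ + γ₂) n
        IH₁ : (a⁺ ⊛ b) n ≈ A′
        IH₁ = trans (Aseq-convolution (λ₁ + 1#) λ₂ γ₁ γ₂ n) (Aseq-cong _ n (xy∙z≈xz∙y λ₁ 1# λ₂))
        IH₂ : (a ⊛ b⁺) n ≈ A′
        IH₂ = trans (Aseq-convolution λ₁ (λ₂ + 1#) γ₁ γ₂ n) (Aseq-cong _ n (sym (+-assoc λ₁ λ₂ 1#)))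
        μ-+ : μ₁ + μ₂ ≈ (λ₁ + λ₂) * β * (1# + x)
        μ-+ = trans (sym (distribʳ (1# + x) _ _)) (*-congʳ (sym (distribʳ β λ₁ λ₂)))
        leibniz-term : ∀ k → k ≤ n →
          binom n k * a (suc k) * b (n ∸ k) + binom n k * a k * b (suc (n ∸ k))
          ≈ δ * summand a b k + μ₁ * summand a⁺ b k + μ₂ * summand a b⁺ k
        leibniz-term k k≤n = begin
          cₙₖ * a (suc k) * b (n ∸ k) + cₙₖ * a k * b (suc (n ∸ k))
            ≈⟨ trans (+-cong (*-assoc _ _ _) (*-assoc _ _ _)) (sym (distribˡ _ _ _)) ⟩
          cₙₖ * (a (suc k) * b (n ∸ k) + a k * b (suc (n ∸ k)))
            ≈⟨ *-congˡ (Aseq-suc-product λ₁ λ₂ γ₁ γ₂ k≤n) ⟩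
          cₙₖ * (δ * (a k * b (n ∸ k)) + μ₁ * (a⁺ k * b (n ∸ k)) + μ₂ * (a k * b⁺ (n ∸ k)))
            ≈⟨ solve 8 (λ c d m₁ m₂ u u⁺ v v⁺ →
                  c :* (d :* (u :* v) :+ m₁ :* (u⁺ :* v) :+ m₂ :* (u :* v⁺))
                  := d :* (c :* u :* v) :+ m₁ :* (c :* u⁺ :* v) :+ m₂ :* (c :* u :* v⁺))
                refl cₙₖ δ μ₁ μ₂ (a k) (a⁺ k) (b (n ∸ k)) (b⁺ (n ∸ k)) ⟩
          δ * summand a b k + μ₁ * summand a⁺ b k + μ₂ * summand a b⁺ k ∎
          where cₙₖ = binom n k

mainTheorem6 : {c ℓ : Level} (R : CommutativeRing c ℓ) →
    let open CommutativeRing R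
        open WithRing R
    in (α β γ₁ γ₂ λ₁ λ₂ x : Carrier) (n : ℕ) →
       sumTo n (λ k → binom n k * A λ₁ x k α β (α + β + γ₁)
                                 * A λ₂ x (n ∸ k) α β γ₂)
       ≈ A (λ₁ + λ₂) x n α β (α + β + γ₁ + γ₂)
mainTheorem6 R α β γ₁ γ₂ λ₁ λ₂ x n =
  Properties.Aseq-convolution R α β x λ₁ λ₂ (α + β + γ₁) γ₂ n
  where open CommutativeRing R using (_+_)
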